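{- Let $n\ge 3$, let $C_n$ be the cycle on $n$ vertices, and let $H$ be an arbitrary connected graph. Then \[F(C_n+_S H)=nF(H)+6nM_1(H)+24n|E(H)|+16n|V(H)|.\]
   Context: All graphs are finite, simple and undirected; $d_G(v)$ denotes degree. $F(G)=\sum_{v\in V(G)}d_G(v)^3$ and $M_1(G)=\sum_{v\in V(G)}d_G(v)^2$. The subdivision graph $S(G)$ is obtained from $G$ by replacing each edge by a path of length two; its vertex set is $V(G)\cup E(G)$. The $S$-sum $G+_S H$ is the graph with vertex set $(V(G)\cup E(G))\times V(H)$ in which $(u,v)$ and $(u',v')$ are adjacent if and only if [$u=u'\in V(G)$ and $vv'\in E(H)$] or [$v=v'$ and $uu'\in E(S(G))$]. -}

module Defs where

open import Data.Bool using (Bool; true; false; _∧_; _∨_; not)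
open import Data.Nat using (ℕ; zero; suc; _+_; _*_; _^_; _≤_; _%_; NonZero)
open import Data.Nat.Properties using () renaming (_≟_ to _≟ℕ_)
open import Data.Fin using (Fin; toℕ)
open import Data.Fin.Properties using () renaming (_≟_ to _≟F_)
open import Data.List using (List; []; _∷_; map; _++_; length; filterᵇ; cartesianProduct; allFin)
open import Data.Nat.ListAction using (sum)
open import Data.List.Membership.Propositional using (_∈_)
open import Data.List.Relation.Unary.Unique.Propositional using (Unique)
open import Data.Sum using (_⊎_; inj₁; inj₂)
open import Data.Product using (_×_; _,_; Σ)
import Data.Sum.Properties as SumP
import Data.Product.Properties as ProdP
open import Relation.Binary.Definitions using (DecidableEquality)
open import Relation.Binary.PropositionalEquality using (_≡_)
open import Relation.Nullary.Decidable using (⌊_⌋)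

record Graph : Set₁ where
  field
    Vtx   : Set
    _≟_   : DecidableEquality Vtx
    verts : List Vtx
    adj   : Vtx → Vtx → Bool
open Graph public

record IsSimple (G : Graph) : Set where
  field
    complete : ∀ (v : Vtx G) → v ∈ verts G
    unique   : Unique (verts G)
    sym      : ∀ u v → adj G u v ≡ adj G v u
    irrefl   : ∀ v → adj G v v ≡ false

data Walk (G : Graph) : Vtx G → Vtx G → Set where
  here : ∀ {v} → Walk G v v
  step : ∀ {u w v} → adj G u w ≡ true → Walk G w v → Walk G u v

Connected : Graph → Set
Connected G = ∀ (u v : Vtx G) → Walk G u v

deg : (G : Graph) → Vtx G → ℕ
deg G v = length (filterᵇ (adj G v) (verts G))

F : Graph → ℕ
F G = sum (map (λ v → deg G v ^ 3) (verts G))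

M₁ : Graph → ℕ
M₁ G = sum (map (λ v → deg G v ^ 2) (verts G))

-- edge list: each edge {x,y} listed once, as (x , y) with x before y in verts
edgesFrom : {V : Set} → (V → V → Bool) → List V → List (V × V)
edgesFrom a []       = []
edgesFrom a (x ∷ xs) = map (x ,_) (filterᵇ (a x) xs) ++ edgesFrom a xs

edges : (G : Graph) → List (Vtx G × Vtx G)
edges G = edgesFrom (adj G) (verts G)

nV : Graph → ℕ
nV G = length (verts G)

nE : Graph → ℕ
nE G = length (edges G)

-- subdivision graph S(G): vertex set V(G) ∪ E(G); a vertex u is adjacent
-- to the edge-vertex (a , b) iff u is an endpoint of it
SVtx : Graph → Set
SVtx G = Vtx G ⊎ (Vtx G × Vtx G)

SdecEq : (G : Graph) → DecidableEquality (SVtx G)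
SdecEq G = SumP.≡-dec (_≟_ G) (ProdP.≡-dec (_≟_ G) (_≟_ G))

Sadj : (G : Graph) → SVtx G → SVtx G → Bool
Sadj G (inj₁ u) (inj₂ (a , b)) = ⌊ _≟_ G u a ⌋ ∨ ⌊ _≟_ G u b ⌋
Sadj G (inj₂ (a , b)) (inj₁ u) = ⌊ _≟_ G u a ⌋ ∨ ⌊ _≟_ G u b ⌋
Sadj G _ _ = false

S : Graph → Graph
S G = record
  { Vtx = SVtx G
  ; _≟_ = SdecEq G
  ; verts = map inj₁ (verts G) ++ map inj₂ (edges G)
  ; adj = Sadj G
  }

isV : {A B : Set} → A ⊎ B → Bool
isV (inj₁ _) = true
isV (inj₂ _) = false

-- S-sum G +S H: vertex set (V(G) ∪ E(G)) × V(H);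
-- (u,v) ~ (u',v') iff [u = u' ∈ V(G) and vv' ∈ E(H)] or [v = v' and uu' ∈ E(S(G))]
_+S_ : Graph → Graph → Graph
G +S H = record
  { Vtx = SVtx G × Vtx H
  ; _≟_ = ProdP.≡-dec (SdecEq G) (_≟_ H)
  ; verts = cartesianProduct (verts (S G)) (verts H)
  ; adj = λ { (u , v) (u' , v') →
        (isV u ∧ ⌊ SdecEq G u u' ⌋ ∧ adj H v v')
      ∨ (⌊ _≟_ H v v' ⌋ ∧ Sadj G u u') }
  }

-- the cycle C_n on vertices 0..n-1, i ~ j iff j ≡ i+1 (mod n) or i ≡ j+1 (mod n)
-- (only used for n ≥ 3; C 0 is the empty graph)
cycleAdj : (m : ℕ) → Fin (suc m) → Fin (suc m) → Bool
cycleAdj m i j = ⌊ toℕ j ≟ℕ (suc (toℕ i) % suc m) ⌋ ∨ ⌊ toℕ i ≟ℕ (suc (toℕ j) % suc m) ⌋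

C : ℕ → Graph
C zero    = record { Vtx = Fin 0 ; _≟_ = _≟F_ ; verts = [] ; adj = λ _ _ → false }
C (suc m) = record { Vtx = Fin (suc m) ; _≟_ = _≟F_ ; verts = allFin (suc m) ; adj = cycleAdj m }

-- Every vertex (u , v) of G +S H with u ∈ V(G) has degree d_H(v) + d_G(u), and every vertex
-- (e , v) with e ∈ E(G) has degree 2. Expanding the cube and summing over the copies with the
-- handshake lemma gives, for all simple G and H,
--   F(G +S H) = |V(G)|F(H) + 6|E(G)|M₁(H) + 6|E(H)|M₁(G) + |V(H)|F(G) + 8|E(G)||V(H)|,
-- and C_n is 2-regular with n vertices and n edges.

module Submission where

open import Defs
open import Data.Bool using (Bool; true; false; _∧_; _∨_; T)
open import Data.Bool.Properties using (∧-assoc; ∧-comm; ∧-identityʳ; ∧-zeroʳ; ∨-comm)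
open import Data.Nat using (ℕ; zero; suc; _+_; _*_; _^_; _≤_; s≤s)
open import Data.Nat.Properties
  using (+-identityʳ; *-distribˡ-+; *-distribʳ-+; *-zeroʳ; *-identityˡ; *-identityʳ; *-comm; *-cancelˡ-≡; 1+n≢n; m≢1+n+m)
  renaming (_≟_ to _≟ℕ_)
open import Data.Nat.ListAction using (sum)
open import Data.Nat.ListAction.Properties using (sum-++)
open import Data.Nat.Tactic.RingSolver using (solve-∀)
open import Data.List using (List; []; _∷_; map; _++_; length; filterᵇ; cartesianProduct; allFin)
open import Data.List.Properties using (map-++; map-cong; map-cong-local; map-∘; length-++; length-map; length-tabulate)
open import Data.List.Membership.Propositional using (_∈_; _∉_)
open import Data.List.Relation.Unary.Any using (here; there)
open import Data.List.Relation.Unary.All using (All; []; _∷_)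
import Data.List.Relation.Unary.All as All
open import Data.List.Relation.Unary.All.Properties using (++⁺; map⁺; all-filter)
open import Data.List.Relation.Unary.AllPairs using (_∷_)
open import Data.List.Relation.Unary.Unique.Propositional using (Unique)
open import Data.Product using (_×_; _,_; proj₁; proj₂)
open import Data.Sum using (inj₁; inj₂)
open import Data.Fin using (Fin; zero; suc; toℕ; fromℕ; inject₁)
open import Data.Fin.Properties using (toℕ-injective; toℕ-fromℕ; toℕ-inject₁; toℕ<n) renaming (_≟_ to _≟ᶠ_)
open import Data.Fin.Relation.Unary.Top using (View; view; ‵fromℕ; ‵inj₁; view-fromℕ; view-inject₁)
open import Data.Nat.DivMod using (_%_; n%n≡0; m<n⇒m%n≡m)
open import Data.List.Membership.Propositional.Properties using (∈-allFin)
open import Data.List.Relation.Unary.Unique.Propositional.Properties using (allFin⁺)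
open import Data.Sum.Properties using (inj₁-injective)
open import Function using (_∘_)
open import Function.Bundles using (_⇔_; mk⇔)
open import Relation.Binary.Definitions using (DecidableEquality)
open import Relation.Binary.PropositionalEquality using (_≡_; _≢_; refl; sym; trans; cong; cong₂; module ≡-Reasoning)
open import Relation.Nullary.Decidable using (T?; Dec; yes; no; ⌊_⌋; isYes≗does; dec-true; dec-false; does-⇔)
open import Relation.Nullary.Negation using (¬_)

-- ⌊_⌋ is isYes, which the library's dec-true/dec-false/does-⇔ (stated for does) do not reduce.
module _ {P : Set} where

  ⌊⌋-yes : (p? : Dec P) → P → ⌊ p? ⌋ ≡ true
  ⌊⌋-yes p? p = trans (isYes≗does p?) (dec-true p? p)

  ⌊⌋-no : (p? : Dec P) → ¬ P → ⌊ p? ⌋ ≡ false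
  ⌊⌋-no p? ¬p = trans (isYes≗does p?) (dec-false p? ¬p)

⌊⌋-⇔ : {P Q : Set} → P ⇔ Q → (p? : Dec P) (q? : Dec Q) → ⌊ p? ⌋ ≡ ⌊ q? ⌋
⌊⌋-⇔ P⇔Q p? q? = trans (isYes≗does p?) (trans (does-⇔ P⇔Q p? q?) (sym (isYes≗does q?)))

𝟙 : Bool → ℕ
𝟙 true  = 1
𝟙 false = 0

∑ : {A : Set} → List A → (A → ℕ) → ℕ
∑ xs f = sum (map f xs)

-- The body of ∑[ x ∈ xs ] extends over + but stops at ≡ and is not an operand of + or *.
infix 5 ∑
syntax ∑ xs (λ x → e) = ∑[ x ∈ xs ] e

count : {A : Set} → (A → Bool) → List A → ℕ
count p xs = ∑[ x ∈ xs ] 𝟙 (p x)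

module _ {A : Set} where

  ∑-cong : {f g : A → ℕ} → (∀ x → f x ≡ g x) → ∀ xs → ∑ xs f ≡ ∑ xs g
  ∑-cong f≗g xs = cong sum (map-cong f≗g xs)

  ∑-cong-local : {f g : A → ℕ} {xs : List A} → All (λ x → f x ≡ g x) xs → ∑ xs f ≡ ∑ xs g
  ∑-cong-local = cong sum ∘ map-cong-local

  ∑-++ : (xs ys : List A) (f : A → ℕ) → ∑ (xs ++ ys) f ≡ ∑ xs f + ∑ ys f
  ∑-++ xs ys f = trans (cong sum (map-++ f xs ys)) (sum-++ (map f xs) (map f ys))

  ∑-map : {B : Set} (g : B → A) (xs : List B) (f : A → ℕ) → ∑ (map g xs) f ≡ ∑ xs (f ∘ g)
  ∑-map g xs f = cong sum (sym (map-∘ xs))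

  ∑-+ : (xs : List A) (f g : A → ℕ) → ∑[ x ∈ xs ] (f x + g x) ≡ ∑ xs f + ∑ xs g
  ∑-+ []       f g = refl
  ∑-+ (x ∷ xs) f g rewrite ∑-+ xs f g = shuffle (f x) (g x) (∑ xs f) (∑ xs g)
    where
    shuffle : ∀ a b c d → a + b + (c + d) ≡ a + c + (b + d)
    shuffle = solve-∀

  ∑-*ˡ : (c : ℕ) (xs : List A) (f : A → ℕ) → ∑[ x ∈ xs ] (c * f x) ≡ c * ∑ xs f
  ∑-*ˡ c []       f = sym (*-zeroʳ c)
  ∑-*ˡ c (x ∷ xs) f = trans (cong (c * f x +_) (∑-*ˡ c xs f)) (sym (*-distribˡ-+ c (f x) (∑ xs f)))

  ∑-*ʳ : (c : ℕ) (xs : List A) (f : A → ℕ) → ∑[ x ∈ xs ] (f x * c) ≡ ∑ xs f * c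
  ∑-*ʳ c []       f = refl
  ∑-*ʳ c (x ∷ xs) f = trans (cong (f x * c +_) (∑-*ʳ c xs f)) (sym (*-distribʳ-+ c (f x) (∑ xs f)))

  ∑-const : (c : ℕ) (xs : List A) → ∑[ x ∈ xs ] c ≡ length xs * c
  ∑-const c []       = refl
  ∑-const c (x ∷ xs) = cong (c +_) (∑-const c xs)

  ∑-cubic : (a b c d : ℕ) (h : A → ℕ) (xs : List A) →
    ∑[ x ∈ xs ] (a + b * h x + c * h x ^ 2 + d * h x ^ 3)
      ≡ length xs * a + b * ∑ xs h + c * (∑[ x ∈ xs ] h x ^ 2) + d * (∑[ x ∈ xs ] h x ^ 3)
  ∑-cubic a b c d h []       = vanish a b c d
    where
    vanish : ∀ a b c d → 0 ≡ 0 * a + b * 0 + c * 0 + d * 0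
    vanish = solve-∀
  ∑-cubic a b c d h (x ∷ xs) =
    trans (cong (a + b * h x + c * h x ^ 2 + d * h x ^ 3 +_) (∑-cubic a b c d h xs))
      (regroup a b c d (h x) (h x ^ 2) (h x ^ 3) (length xs) (∑ xs h) (∑[ x ∈ xs ] h x ^ 2) (∑[ x ∈ xs ] h x ^ 3))
    where
    regroup : ∀ a b c d y₁ y₂ y₃ n s₁ s₂ s₃ →
      a + b * y₁ + c * y₂ + d * y₃ + (n * a + b * s₁ + c * s₂ + d * s₃)
        ≡ suc n * a + b * (y₁ + s₁) + c * (y₂ + s₂) + d * (y₃ + s₃)
    regroup = solve-∀

∑-cartesianProduct : {A B : Set} (xs : List A) (ys : List B) (f : A × B → ℕ) →
  ∑ (cartesianProduct xs ys) f ≡ ∑[ x ∈ xs ] ∑[ y ∈ ys ] f (x , y)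
∑-cartesianProduct []       ys f = refl
∑-cartesianProduct (x ∷ xs) ys f =
  trans (∑-++ (map (x ,_) ys) (cartesianProduct xs ys) f)
        (cong₂ _+_ (∑-map (x ,_) ys f) (∑-cartesianProduct xs ys f))

∑-∑-product : {A B : Set} (xs : List A) (ys : List B) (f : A → ℕ) (g : B → ℕ) →
  ∑[ x ∈ xs ] ∑[ y ∈ ys ] f x * g y ≡ ∑ xs f * ∑ ys g
∑-∑-product xs ys f g = trans (∑-cong (λ x → ∑-*ˡ (f x) ys g) xs) (∑-*ʳ (∑ ys g) xs f)

∑-∑-cube-+ : {A B : Set} (xs : List A) (ys : List B) (g : A → ℕ) (f : B → ℕ) →
  ∑[ x ∈ xs ] ∑[ y ∈ ys ] (f y + g x) ^ 3
    ≡ length xs * (∑[ y ∈ ys ] f y ^ 3) + 3 * (∑[ y ∈ ys ] f y ^ 2) * ∑ xs g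
      + 3 * ∑ ys f * (∑[ x ∈ xs ] g x ^ 2) + length ys * (∑[ x ∈ xs ] g x ^ 3)
∑-∑-cube-+ xs ys g f = begin
  ∑[ x ∈ xs ] ∑[ y ∈ ys ] (f y + g x) ^ 3
    ≡⟨ ∑-cong (λ x → ∑-cong (λ y → binomial (f y) (g x)) ys) xs ⟩
  ∑[ x ∈ xs ] ∑[ y ∈ ys ] (g x ^ 3 + 3 * g x ^ 2 * f y + 3 * g x * f y ^ 2 + 1 * f y ^ 3)
    ≡⟨ ∑-cong (λ x → ∑-cubic (g x ^ 3) (3 * g x ^ 2) (3 * g x) 1 f ys) xs ⟩
  ∑[ x ∈ xs ] (length ys * g x ^ 3 + 3 * g x ^ 2 * S₁ + 3 * g x * S₂ + 1 * S₃)
    ≡⟨ ∑-cong (λ x → regroup (length ys) S₁ S₂ S₃ (g x) (g x ^ 2) (g x ^ 3)) xs ⟩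
  ∑[ x ∈ xs ] (S₃ + 3 * S₂ * g x + 3 * S₁ * g x ^ 2 + length ys * g x ^ 3)
    ≡⟨ ∑-cubic S₃ (3 * S₂) (3 * S₁) (length ys) g xs ⟩
  length xs * S₃ + 3 * S₂ * ∑ xs g + 3 * S₁ * (∑[ x ∈ xs ] g x ^ 2) + length ys * (∑[ x ∈ xs ] g x ^ 3) ∎
  where
  open ≡-Reasoning
  S₁ S₂ S₃ : ℕ
  S₁ = ∑ ys f
  S₂ = ∑[ y ∈ ys ] f y ^ 2
  S₃ = ∑[ y ∈ ys ] f y ^ 3
  -- The ring solver does not accept _^_, so the expansion is stated with the powers unfolded.
  binomial′ : ∀ p c → (p + c) * ((p + c) * ((p + c) * 1))
    ≡ c * (c * (c * 1)) + 3 * (c * (c * 1)) * p + 3 * c * (p * (p * 1)) + 1 * (p * (p * (p * 1)))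
  binomial′ = solve-∀
  binomial : ∀ p c → (p + c) ^ 3 ≡ c ^ 3 + 3 * c ^ 2 * p + 3 * c * p ^ 2 + 1 * p ^ 3
  binomial = binomial′
  regroup : ∀ n s₁ s₂ s₃ c₁ c₂ c₃ →
    n * c₃ + 3 * c₂ * s₁ + 3 * c₁ * s₂ + 1 * s₃ ≡ s₃ + 3 * s₂ * c₁ + 3 * s₁ * c₂ + n * c₃
  regroup = solve-∀

𝟙-∧ : ∀ a b → 𝟙 (a ∧ b) ≡ 𝟙 a * 𝟙 b
𝟙-∧ true  b = sym (*-identityˡ (𝟙 b))
𝟙-∧ false b = refl

𝟙-∨ : ∀ a b → a ∧ b ≡ false → 𝟙 (a ∨ b) ≡ 𝟙 a + 𝟙 b
𝟙-∨ true  false _ = refl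
𝟙-∨ false b     _ = refl

module _ {A : Set} where

  length-filterᵇ : (p : A → Bool) (xs : List A) → length (filterᵇ p xs) ≡ count p xs
  length-filterᵇ p []       = refl
  length-filterᵇ p (x ∷ xs) with p x
  ... | true  = cong suc (length-filterᵇ p xs)
  ... | false = length-filterᵇ p xs

  count-filterᵇ : (p q : A → Bool) (xs : List A) → count p (filterᵇ q xs) ≡ count (λ x → q x ∧ p x) xs
  count-filterᵇ p q []       = refl
  count-filterᵇ p q (x ∷ xs) with q x
  ... | true  = cong (𝟙 (p x) +_) (count-filterᵇ p q xs)
  ... | false = count-filterᵇ p q xs

  count-false : (xs : List A) → count (λ _ → false) xs ≡ 0
  count-false xs = trans (∑-const 0 xs) (*-zeroʳ (length xs))

  count-∨ : (p q : A → Bool) → (∀ x → p x ∧ q x ≡ false) → (xs : List A) →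
    count (λ x → p x ∨ q x) xs ≡ count p xs + count q xs
  count-∨ p q disjoint xs = trans (∑-cong (λ x → 𝟙-∨ (p x) (q x) (disjoint x)) xs) (∑-+ xs (𝟙 ∘ p) (𝟙 ∘ q))

  module _ (eq? : DecidableEquality A) where

    count-≟-∉ : {a : A} {xs : List A} → a ∉ xs → count (λ y → ⌊ eq? a y ⌋) xs ≡ 0
    count-≟-∉ {a} {[]}     a∉xs = refl
    count-≟-∉ {a} {x ∷ xs} a∉xs =
      cong₂ _+_ (cong 𝟙 (⌊⌋-no (eq? a x) (a∉xs ∘ here))) (count-≟-∉ (a∉xs ∘ there))

    count-≟-∈ : {a : A} {xs : List A} → Unique xs → a ∈ xs → count (λ y → ⌊ eq? a y ⌋) xs ≡ 1
    count-≟-∈ {a} (a∉xs ∷ _) (here refl) =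
      cong₂ _+_ (cong 𝟙 (⌊⌋-yes (eq? a a) refl)) (count-≟-∉ (λ a∈xs → All.lookup a∉xs a∈xs refl))
    count-≟-∈ {a} {x ∷ _} (x∉xs ∷ xs-unique) (there a∈xs) =
      cong₂ _+_ (cong 𝟙 (⌊⌋-no (eq? a x) (λ a≡x → All.lookup x∉xs a∈xs (sym a≡x))))
                (count-≟-∈ xs-unique a∈xs)

count-cartesianProduct : {A B : Set} (f : A → Bool) (g : B → Bool) (xs : List A) (ys : List B) →
  count (λ w → f (proj₁ w) ∧ g (proj₂ w)) (cartesianProduct xs ys) ≡ count f xs * count g ys
count-cartesianProduct f g xs ys = begin
  count (λ w → f (proj₁ w) ∧ g (proj₂ w)) (cartesianProduct xs ys)
    ≡⟨ ∑-cartesianProduct xs ys _ ⟩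
  ∑[ x ∈ xs ] ∑[ y ∈ ys ] 𝟙 (f x ∧ g y)
    ≡⟨ ∑-cong (λ x → ∑-cong (𝟙-∧ (f x) ∘ g) ys) xs ⟩
  ∑[ x ∈ xs ] ∑[ y ∈ ys ] 𝟙 (f x) * 𝟙 (g y)
    ≡⟨ ∑-∑-product xs ys (𝟙 ∘ f) (𝟙 ∘ g) ⟩
  count f xs * count g ys ∎
  where open ≡-Reasoning

incident : {V : Set} → DecidableEquality V → V → V × V → Bool
incident eq? u (x , y) = ⌊ eq? u x ⌋ ∨ ⌊ eq? u y ⌋

module _ {V : Set} (_∼_ : V → V → Bool) where

  -- edgesFrom _∼_ (x ∷ ys) is star x ys ++ edgesFrom _∼_ ys by definition.
  star : V → List V → List (V × V)
  star x ys = map (x ,_) (filterᵇ (x ∼_) ys)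

  count-star : (p : V × V → Bool) (x : V) (ys : List V) →
    count p (star x ys) ≡ count (λ y → (x ∼ y) ∧ p (x , y)) ys
  count-star p x ys = trans (∑-map (x ,_) (filterᵇ (x ∼_) ys) (𝟙 ∘ p)) (count-filterᵇ (p ∘ (x ,_)) (x ∼_) ys)

  edgesFrom-adjacent : (xs : List V) → All (λ e → T (proj₁ e ∼ proj₂ e)) (edgesFrom _∼_ xs)
  edgesFrom-adjacent []       = []
  edgesFrom-adjacent (x ∷ ys) = ++⁺ (map⁺ (all-filter (T? ∘ (x ∼_)) ys)) (edgesFrom-adjacent ys)

  module _ (eq? : DecidableEquality V) where

    count-incident-star : (x : V) (ys : List V) →
      count (incident eq? x) (star x ys) ≡ count (x ∼_) ys
    count-incident-star x ys = begin
      count (incident eq? x) (star x ys)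
        ≡⟨ count-star (incident eq? x) x ys ⟩
      count (λ y → (x ∼ y) ∧ (⌊ eq? x x ⌋ ∨ ⌊ eq? x y ⌋)) ys
        ≡⟨ ∑-cong (λ y → cong (λ b → 𝟙 ((x ∼ y) ∧ (b ∨ ⌊ eq? x y ⌋))) (⌊⌋-yes (eq? x x) refl)) ys ⟩
      count (λ y → (x ∼ y) ∧ true) ys
        ≡⟨ ∑-cong (λ y → cong 𝟙 (∧-identityʳ (x ∼ y))) ys ⟩
      count (x ∼_) ys ∎
      where open ≡-Reasoning

    count-incident-star-≢ : {u x : V} (ys : List V) → u ≢ x →
      count (incident eq? u) (star x ys) ≡ 𝟙 (x ∼ u) * count (λ y → ⌊ eq? u y ⌋) ys
    count-incident-star-≢ {u} {x} ys u≢x = begin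
      count (incident eq? u) (star x ys)
        ≡⟨ count-star (incident eq? u) x ys ⟩
      count (λ y → (x ∼ y) ∧ (⌊ eq? u x ⌋ ∨ ⌊ eq? u y ⌋)) ys
        ≡⟨ ∑-cong (λ y → cong (λ b → 𝟙 ((x ∼ y) ∧ (b ∨ ⌊ eq? u y ⌋))) (⌊⌋-no (eq? u x) u≢x)) ys ⟩
      count (λ y → (x ∼ y) ∧ ⌊ eq? u y ⌋) ys
        ≡⟨ ∑-cong only-u ys ⟩
      ∑[ y ∈ ys ] 𝟙 (x ∼ u) * 𝟙 ⌊ eq? u y ⌋
        ≡⟨ ∑-*ˡ (𝟙 (x ∼ u)) ys (λ y → 𝟙 ⌊ eq? u y ⌋) ⟩
      𝟙 (x ∼ u) * count (λ y → ⌊ eq? u y ⌋) ys ∎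
      where
      open ≡-Reasoning
      only-u : ∀ y → 𝟙 ((x ∼ y) ∧ ⌊ eq? u y ⌋) ≡ 𝟙 (x ∼ u) * 𝟙 ⌊ eq? u y ⌋
      only-u y with eq? u y
      ... | yes refl = trans (cong 𝟙 (∧-identityʳ (x ∼ u))) (sym (*-identityʳ (𝟙 (x ∼ u))))
      ... | no _     = trans (cong 𝟙 (∧-zeroʳ (x ∼ y))) (sym (*-zeroʳ (𝟙 (x ∼ u))))

    count-incident-∉ : {u : V} {xs : List V} → u ∉ xs → count (incident eq? u) (edgesFrom _∼_ xs) ≡ 0
    count-incident-∉ {u} {[]}     u∉xs = refl
    count-incident-∉ {u} {x ∷ ys} u∉xs = begin
      count (incident eq? u) (star x ys ++ edgesFrom _∼_ ys)
        ≡⟨ ∑-++ (star x ys) (edgesFrom _∼_ ys) (𝟙 ∘ incident eq? u) ⟩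
      count (incident eq? u) (star x ys) + count (incident eq? u) (edgesFrom _∼_ ys)
        ≡⟨ cong₂ _+_ (count-incident-star-≢ ys (u∉xs ∘ here)) (count-incident-∉ (u∉xs ∘ there)) ⟩
      𝟙 (x ∼ u) * count (λ y → ⌊ eq? u y ⌋) ys + 0
        ≡⟨ cong (λ c → 𝟙 (x ∼ u) * c + 0) (count-≟-∉ eq? (u∉xs ∘ there)) ⟩
      𝟙 (x ∼ u) * 0 + 0
        ≡⟨ cong (_+ 0) (*-zeroʳ (𝟙 (x ∼ u))) ⟩
      0 ∎
      where open ≡-Reasoning

  module _ (∼-sym : ∀ u v → u ∼ v ≡ v ∼ u) (∼-irrefl : ∀ v → v ∼ v ≡ false) where

    handshake-edgesFrom : (xs : List V) → ∑[ v ∈ xs ] count (v ∼_) xs ≡ 2 * length (edgesFrom _∼_ xs)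
    handshake-edgesFrom []       = refl
    handshake-edgesFrom (x ∷ ys) = begin
      𝟙 (x ∼ x) + count (x ∼_) ys + (∑[ v ∈ ys ] (𝟙 (v ∼ x) + count (v ∼_) ys))
        ≡⟨ cong₂ _+_ (cong (λ b → 𝟙 b + count (x ∼_) ys) (∼-irrefl x))
                     (∑-+ ys (λ v → 𝟙 (v ∼ x)) (λ v → count (v ∼_) ys)) ⟩
      count (x ∼_) ys + (count (_∼ x) ys + (∑[ v ∈ ys ] count (v ∼_) ys))
        ≡⟨ cong₂ (λ c s → count (x ∼_) ys + (c + s))
                 (∑-cong (λ v → cong 𝟙 (∼-sym v x)) ys) (handshake-edgesFrom ys) ⟩
      count (x ∼_) ys + (count (x ∼_) ys + 2 * length (edgesFrom _∼_ ys))
        ≡⟨ double (count (x ∼_) ys) (length (edgesFrom _∼_ ys)) ⟩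
      2 * (count (x ∼_) ys + length (edgesFrom _∼_ ys))
        ≡⟨ cong (λ c → 2 * (c + length (edgesFrom _∼_ ys)))
                (sym (trans (length-map (x ,_) (filterᵇ (x ∼_) ys)) (length-filterᵇ (x ∼_) ys))) ⟩
      2 * (length (star x ys) + length (edgesFrom _∼_ ys))
        ≡⟨ cong (2 *_) (sym (length-++ (star x ys))) ⟩
      2 * length (edgesFrom _∼_ (x ∷ ys)) ∎
      where
      open ≡-Reasoning
      double : ∀ c e → c + (c + 2 * e) ≡ 2 * (c + e)
      double = solve-∀

    module _ (eq? : DecidableEquality V) where

      count-incident-∈ : {u : V} {xs : List V} → Unique xs → u ∈ xs →
        count (incident eq? u) (edgesFrom _∼_ xs) ≡ count (u ∼_) xs
      count-incident-∈ {u} {.u ∷ ys} (u∉ys ∷ _) (here refl) = begin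
        count (incident eq? u) (star u ys ++ edgesFrom _∼_ ys)
          ≡⟨ ∑-++ (star u ys) (edgesFrom _∼_ ys) (𝟙 ∘ incident eq? u) ⟩
        count (incident eq? u) (star u ys) + count (incident eq? u) (edgesFrom _∼_ ys)
          ≡⟨ cong₂ _+_ (count-incident-star eq? u ys) (count-incident-∉ eq? (λ u∈ys → All.lookup u∉ys u∈ys refl)) ⟩
        count (u ∼_) ys + 0
          ≡⟨ +-identityʳ (count (u ∼_) ys) ⟩
        count (u ∼_) ys
          ≡⟨ cong (λ b → 𝟙 b + count (u ∼_) ys) (sym (∼-irrefl u)) ⟩
        count (u ∼_) (u ∷ ys) ∎
        where open ≡-Reasoning
      count-incident-∈ {u} {x ∷ ys} (x∉ys ∷ ys-unique) (there u∈ys) = begin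
        count (incident eq? u) (star x ys ++ edgesFrom _∼_ ys)
          ≡⟨ ∑-++ (star x ys) (edgesFrom _∼_ ys) (𝟙 ∘ incident eq? u) ⟩
        count (incident eq? u) (star x ys) + count (incident eq? u) (edgesFrom _∼_ ys)
          ≡⟨ cong₂ _+_ (count-incident-star-≢ eq? ys u≢x) (count-incident-∈ ys-unique u∈ys) ⟩
        𝟙 (x ∼ u) * count (λ y → ⌊ eq? u y ⌋) ys + count (u ∼_) ys
          ≡⟨ cong (λ c → 𝟙 (x ∼ u) * c + count (u ∼_) ys) (count-≟-∈ eq? ys-unique u∈ys) ⟩
        𝟙 (x ∼ u) * 1 + count (u ∼_) ys
          ≡⟨ cong (_+ count (u ∼_) ys) (trans (*-identityʳ (𝟙 (x ∼ u))) (cong 𝟙 (∼-sym x u))) ⟩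
        count (u ∼_) (x ∷ ys) ∎
        where
        open ≡-Reasoning
        u≢x : u ≢ x
        u≢x u≡x = All.lookup x∉ys u∈ys (sym u≡x)

module _ {G : Graph} (G-simple : IsSimple G) where
  open IsSimple G-simple renaming (sym to adj-sym; irrefl to adj-irrefl)

  handshake : ∑ (verts G) (deg G) ≡ 2 * nE G
  handshake = trans (∑-cong (λ v → length-filterᵇ (adj G v) (verts G)) (verts G))
                    (handshake-edgesFrom (adj G) adj-sym adj-irrefl (verts G))

  edge-ends-distinct : All (λ e → proj₁ e ≢ proj₂ e) (edges G)
  edge-ends-distinct = All.map loop-free (edgesFrom-adjacent (adj G) (verts G))
    where
    loop-free : {e : Vtx G × Vtx G} → T (adj G (proj₁ e) (proj₂ e)) → proj₁ e ≢ proj₂ e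
    loop-free {x , .x} adjacent refl rewrite adj-irrefl x = adjacent

  deg-S-vertex : (u : Vtx G) → deg (S G) (inj₁ u) ≡ deg G u
  deg-S-vertex u = begin
    deg (S G) (inj₁ u)
      ≡⟨ length-filterᵇ (Sadj G (inj₁ u)) (verts (S G)) ⟩
    count (Sadj G (inj₁ u)) (map inj₁ (verts G) ++ map inj₂ (edges G))
      ≡⟨ ∑-++ (map inj₁ (verts G)) (map inj₂ (edges G)) (𝟙 ∘ Sadj G (inj₁ u)) ⟩
    count (Sadj G (inj₁ u)) (map inj₁ (verts G)) + count (Sadj G (inj₁ u)) (map inj₂ (edges G))
      ≡⟨ cong₂ _+_ (trans (∑-map inj₁ (verts G) _) (count-false (verts G))) (∑-map inj₂ (edges G) _) ⟩
    count (incident (_≟_ G) u) (edges G)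
      ≡⟨ count-incident-∈ (adj G) adj-sym adj-irrefl (_≟_ G) unique (complete u) ⟩
    count (adj G u) (verts G)
      ≡⟨ length-filterᵇ (adj G u) (verts G) ⟨
    deg G u ∎
    where open ≡-Reasoning

  deg-S-edge : {a b : Vtx G} → a ≢ b → deg (S G) (inj₂ (a , b)) ≡ 2
  deg-S-edge {a} {b} a≢b = begin
    deg (S G) (inj₂ (a , b))
      ≡⟨ length-filterᵇ (Sadj G (inj₂ (a , b))) (verts (S G)) ⟩
    count (Sadj G (inj₂ (a , b))) (map inj₁ (verts G) ++ map inj₂ (edges G))
      ≡⟨ ∑-++ (map inj₁ (verts G)) (map inj₂ (edges G)) (𝟙 ∘ Sadj G (inj₂ (a , b))) ⟩
    count (Sadj G (inj₂ (a , b))) (map inj₁ (verts G))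
      + count (Sadj G (inj₂ (a , b))) (map inj₂ (edges G))
      ≡⟨ cong₂ _+_ (∑-map inj₁ (verts G) _) (trans (∑-map inj₂ (edges G) _) (count-false (edges G))) ⟩
    count (λ w → ⌊ _≟_ G w a ⌋ ∨ ⌊ _≟_ G w b ⌋) (verts G) + 0
      ≡⟨ cong (_+ 0) (count-∨ _ _ not-both (verts G)) ⟩
    count (λ w → ⌊ _≟_ G w a ⌋) (verts G) + count (λ w → ⌊ _≟_ G w b ⌋) (verts G) + 0
      ≡⟨ cong₂ (λ p q → p + q + 0) (occurs-once a) (occurs-once b) ⟩
    2 ∎
    where
    open ≡-Reasoning
    not-both : ∀ w → ⌊ _≟_ G w a ⌋ ∧ ⌊ _≟_ G w b ⌋ ≡ false
    not-both w with _≟_ G w a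
    ... | yes refl = ⌊⌋-no (_≟_ G w b) a≢b
    ... | no _     = refl
    occurs-once : ∀ c → count (λ w → ⌊ _≟_ G w c ⌋) (verts G) ≡ 1
    occurs-once c = trans (∑-cong (λ w → cong 𝟙 (⌊⌋-⇔ (mk⇔ sym sym) (_≟_ G w c) (_≟_ G c w))) (verts G))
                          (count-≟-∈ (_≟_ G) unique (complete c))

  count-S-≟-isV : (x : SVtx G) → count (λ x' → isV x ∧ ⌊ SdecEq G x x' ⌋) (verts (S G)) ≡ 𝟙 (isV x)
  count-S-≟-isV (inj₂ e) = count-false (verts (S G))
  count-S-≟-isV (inj₁ u) = begin
    count (λ x' → ⌊ SdecEq G (inj₁ u) x' ⌋) (map inj₁ (verts G) ++ map inj₂ (edges G))
      ≡⟨ ∑-++ (map inj₁ (verts G)) (map inj₂ (edges G)) _ ⟩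
    count (λ x' → ⌊ SdecEq G (inj₁ u) x' ⌋) (map inj₁ (verts G))
      + count (λ x' → ⌊ SdecEq G (inj₁ u) x' ⌋) (map inj₂ (edges G))
      ≡⟨ cong₂ _+_ (∑-map inj₁ (verts G) _) (∑-map inj₂ (edges G) _) ⟩
    count (λ w → ⌊ SdecEq G (inj₁ u) (inj₁ w) ⌋) (verts G)
      + count (λ e → ⌊ SdecEq G (inj₁ u) (inj₂ e) ⌋) (edges G)
      ≡⟨ cong₂ _+_ (∑-cong (λ w → cong 𝟙 (⌊⌋-⇔ (mk⇔ inj₁-injective (cong inj₁))
                                                   (SdecEq G (inj₁ u) (inj₁ w)) (_≟_ G u w)))
                           (verts G))
                   (trans (∑-cong (λ e → cong 𝟙 (⌊⌋-no (SdecEq G (inj₁ u) (inj₂ e)) λ ())) (edges G))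
                          (count-false (edges G))) ⟩
    count (λ w → ⌊ _≟_ G u w ⌋) (verts G) + 0
      ≡⟨ cong (_+ 0) (count-≟-∈ (_≟_ G) unique (complete u)) ⟩
    1 ∎
    where open ≡-Reasoning

module _ {G H : Graph} (G-simple : IsSimple G) (H-simple : IsSimple H) where
  open IsSimple H-simple using (unique; complete) renaming (irrefl to adjH-irrefl)

  deg-+S : (x : SVtx G) (v : Vtx H) → deg (G +S H) (x , v) ≡ 𝟙 (isV x) * deg H v + deg (S G) x
  deg-+S x v = begin
    deg (G +S H) (x , v)
      ≡⟨ length-filterᵇ (adj (G +S H) (x , v)) (verts (G +S H)) ⟩
    count (adj (G +S H) (x , v)) (cartesianProduct L (verts H))
      ≡⟨ ∑-cong (λ w → cong 𝟙 (split w)) (cartesianProduct L (verts H)) ⟩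
    count (λ w → P w ∨ Q w) (cartesianProduct L (verts H))
      ≡⟨ count-∨ P Q not-both (cartesianProduct L (verts H)) ⟩
    count P (cartesianProduct L (verts H)) + count Q (cartesianProduct L (verts H))
      ≡⟨ cong₂ _+_ (count-cartesianProduct same-copy (adj H v) L (verts H))
                   (count-cartesianProduct (Sadj G x) (λ v' → ⌊ _≟_ H v v' ⌋) L (verts H)) ⟩
    count same-copy L * count (adj H v) (verts H)
      + count (Sadj G x) L * count (λ v' → ⌊ _≟_ H v v' ⌋) (verts H)
      ≡⟨ cong₂ _+_ (cong₂ _*_ (count-S-≟-isV G-simple x) (sym (length-filterᵇ (adj H v) (verts H))))
                   (cong₂ _*_ (sym (length-filterᵇ (Sadj G x) L)) (count-≟-∈ (_≟_ H) unique (complete v))) ⟩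
    𝟙 (isV x) * deg H v + deg (S G) x * 1
      ≡⟨ cong (𝟙 (isV x) * deg H v +_) (*-identityʳ (deg (S G) x)) ⟩
    𝟙 (isV x) * deg H v + deg (S G) x ∎
    where
    open ≡-Reasoning
    L : List (SVtx G)
    L = verts (S G)
    same-copy : SVtx G → Bool
    same-copy x' = isV x ∧ ⌊ SdecEq G x x' ⌋
    P Q : SVtx G × Vtx H → Bool
    P (x' , v') = same-copy x' ∧ adj H v v'
    Q (x' , v') = Sadj G x x' ∧ ⌊ _≟_ H v v' ⌋
    split : ∀ w → adj (G +S H) (x , v) w ≡ (P w ∨ Q w)
    split (x' , v') = cong₂ _∨_ (sym (∧-assoc (isV x) _ _)) (∧-comm ⌊ _≟_ H v v' ⌋ (Sadj G x x'))
    not-both : ∀ w → P w ∧ Q w ≡ false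
    not-both (x' , v') with _≟_ H v v'
    ... | yes refl rewrite adjH-irrefl v | ∧-zeroʳ (same-copy x') = refl
    ... | no _     rewrite ∧-zeroʳ (Sadj G x x') = ∧-zeroʳ (P (x' , v'))

  F-+S : F (G +S H) ≡ nV G * F H + 6 * nE G * M₁ H + 6 * nE H * M₁ G + nV H * F G + 8 * nE G * nV H
  F-+S = begin
    F (G +S H)
      ≡⟨ ∑-cartesianProduct (verts (S G)) (verts H) (λ w → deg (G +S H) w ^ 3) ⟩
    ∑[ x ∈ map inj₁ (verts G) ++ map inj₂ (edges G) ] ∑[ v ∈ verts H ] deg (G +S H) (x , v) ^ 3
      ≡⟨ ∑-++ (map inj₁ (verts G)) (map inj₂ (edges G)) _ ⟩
    (∑[ x ∈ map inj₁ (verts G) ] ∑[ v ∈ verts H ] deg (G +S H) (x , v) ^ 3)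
      + (∑[ x ∈ map inj₂ (edges G) ] ∑[ v ∈ verts H ] deg (G +S H) (x , v) ^ 3)
      ≡⟨ cong₂ _+_ (∑-map inj₁ (verts G) _) (∑-map inj₂ (edges G) _) ⟩
    (∑[ u ∈ verts G ] ∑[ v ∈ verts H ] deg (G +S H) (inj₁ u , v) ^ 3)
      + (∑[ e ∈ edges G ] ∑[ v ∈ verts H ] deg (G +S H) (inj₂ e , v) ^ 3)
      ≡⟨ cong₂ _+_ (∑-cong (λ u → ∑-cong (λ v → cong (_^ 3) (deg-vertex-copy u v)) (verts H)) (verts G))
                   (∑-cong-local (All.map (λ a≢b → ∑-cong (λ v → cong (_^ 3) (deg-edge-copy a≢b v)) (verts H))
                                          (edge-ends-distinct G-simple))) ⟩
    (∑[ u ∈ verts G ] ∑[ v ∈ verts H ] (deg H v + deg G u) ^ 3) + (∑[ e ∈ edges G ] ∑[ v ∈ verts H ] 8)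
      ≡⟨ cong₂ _+_ (∑-∑-cube-+ (verts G) (verts H) (deg G) (deg H))
                   (trans (∑-cong (λ _ → ∑-const 8 (verts H)) (edges G)) (∑-const (nV H * 8) (edges G))) ⟩
    nV G * F H + 3 * M₁ H * ∑ (verts G) (deg G) + 3 * ∑ (verts H) (deg H) * M₁ G + nV H * F G + nE G * (nV H * 8)
      ≡⟨ cong₂ (λ s t → nV G * F H + 3 * M₁ H * s + 3 * t * M₁ G + nV H * F G + nE G * (nV H * 8))
               (handshake G-simple) (handshake H-simple) ⟩
    nV G * F H + 3 * M₁ H * (2 * nE G) + 3 * (2 * nE H) * M₁ G + nV H * F G + nE G * (nV H * 8)
      ≡⟨ collect (nV G) (nE G) (F G) (M₁ G) (nV H) (nE H) (F H) (M₁ H) ⟩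
    nV G * F H + 6 * nE G * M₁ H + 6 * nE H * M₁ G + nV H * F G + 8 * nE G * nV H ∎
    where
    open ≡-Reasoning
    deg-vertex-copy : ∀ u v → deg (G +S H) (inj₁ u , v) ≡ deg H v + deg G u
    deg-vertex-copy u v = trans (deg-+S (inj₁ u) v) (cong₂ _+_ (*-identityˡ (deg H v)) (deg-S-vertex G-simple u))
    deg-edge-copy : ∀ {e} → proj₁ e ≢ proj₂ e → ∀ v → deg (G +S H) (inj₂ e , v) ≡ 2
    deg-edge-copy a≢b v = trans (deg-+S (inj₂ _) v) (deg-S-edge G-simple a≢b)
    collect : ∀ nVG nEG FG M₁G nVH nEH FH M₁H →
      nVG * FH + 3 * M₁H * (2 * nEG) + 3 * (2 * nEH) * M₁G + nVH * FG + nEG * (nVH * 8)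
        ≡ nVG * FH + 6 * nEG * M₁H + 6 * nEH * M₁G + nVH * FG + 8 * nEG * nVH
    collect = solve-∀

module _ (G : Graph) {r : ℕ} (regular : ∀ v → deg G v ≡ r) where

  M₁-regular : M₁ G ≡ nV G * r ^ 2
  M₁-regular = trans (∑-cong (cong (_^ 2) ∘ regular) (verts G)) (∑-const (r ^ 2) (verts G))

  F-regular : F G ≡ nV G * r ^ 3
  F-regular = trans (∑-cong (cong (_^ 3) ∘ regular) (verts G)) (∑-const (r ^ 3) (verts G))

  handshake-regular : IsSimple G → 2 * nE G ≡ nV G * r
  handshake-regular G-simple =
    trans (sym (handshake G-simple)) (trans (∑-cong regular (verts G)) (∑-const r (verts G)))

-- Cyclic successor and predecessor; defining sucᶜ through the top view of Fin makes
-- predᶜ ∘ sucᶜ the identity by computation.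
sucᵛ : {m : ℕ} {i : Fin (suc m)} → View i → Fin (suc m)
sucᵛ ‵fromℕ          = zero
sucᵛ (‵inj₁ {i = j} _) = suc j

sucᶜ : {m : ℕ} → Fin (suc m) → Fin (suc m)
sucᶜ i = sucᵛ (view i)

predᶜ : {m : ℕ} → Fin (suc m) → Fin (suc m)
predᶜ zero    = fromℕ _
predᶜ (suc j) = inject₁ j

module _ {m : ℕ} where

  toℕ-sucᶜ : (i : Fin (suc m)) → toℕ (sucᶜ i) ≡ suc (toℕ i) % suc m
  toℕ-sucᶜ i = toℕ-sucᵛ (view i)
    where
    toℕ-sucᵛ : {i : Fin (suc m)} (v : View i) → toℕ (sucᵛ v) ≡ suc (toℕ i) % suc m
    toℕ-sucᵛ ‵fromℕ               rewrite toℕ-fromℕ m   = sym (n%n≡0 (suc m))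
    toℕ-sucᵛ (‵inj₁ {i = j} _) rewrite toℕ-inject₁ j = sym (m<n⇒m%n≡m (s≤s (toℕ<n j)))

  predᶜ-sucᶜ : (i : Fin (suc m)) → predᶜ (sucᶜ i) ≡ i
  predᶜ-sucᶜ i = predᶜ-sucᵛ (view i)
    where
    predᶜ-sucᵛ : {i : Fin (suc m)} (v : View i) → predᶜ (sucᵛ v) ≡ i
    predᶜ-sucᵛ ‵fromℕ   = refl
    predᶜ-sucᵛ (‵inj₁ _) = refl

  sucᶜ-predᶜ : (i : Fin (suc m)) → sucᶜ (predᶜ i) ≡ i
  sucᶜ-predᶜ zero    = cong sucᵛ (view-fromℕ m)
  sucᶜ-predᶜ (suc j) = cong sucᵛ (view-inject₁ j)

  cycleAdj-neighbours : (i j : Fin (suc m)) → cycleAdj m i j ≡ ⌊ sucᶜ i ≟ᶠ j ⌋ ∨ ⌊ predᶜ i ≟ᶠ j ⌋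
  cycleAdj-neighbours i j = cong₂ _∨_
    (⌊⌋-⇔ (mk⇔ (λ j≡ → toℕ-injective (trans (toℕ-sucᶜ i) (sym j≡))) (λ { refl → toℕ-sucᶜ i }))
          (toℕ j ≟ℕ suc (toℕ i) % suc m) (sucᶜ i ≟ᶠ j))
    (⌊⌋-⇔ (mk⇔ (λ i≡ → trans (cong predᶜ (toℕ-injective (trans i≡ (sym (toℕ-sucᶜ j))))) (predᶜ-sucᶜ j))
               (λ { refl → trans (cong toℕ (sym (sucᶜ-predᶜ i))) (toℕ-sucᶜ (predᶜ i)) }))
          (toℕ i ≟ℕ suc (toℕ j) % suc m) (predᶜ i ≟ᶠ j))

sucᶜ≢id : {m : ℕ} (i : Fin (suc (suc m))) → sucᶜ i ≢ i
sucᶜ≢id i = sucᵛ≢id (view i)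
  where
  sucᵛ≢id : ∀ {m} {i : Fin (suc (suc m))} (v : View i) → sucᵛ v ≢ i
  sucᵛ≢id ‵fromℕ ()
  sucᵛ≢id (‵inj₁ {i = j} _) suc-j≡j = 1+n≢n (trans (cong toℕ suc-j≡j) (toℕ-inject₁ j))

sucᶜ≢predᶜ : {m : ℕ} (i : Fin (suc (suc (suc m)))) → sucᶜ i ≢ predᶜ i
sucᶜ≢predᶜ i = sucᵛ≢predᶜ (view i)
  where
  sucᵛ≢predᶜ : ∀ {m} {i : Fin (suc (suc (suc m)))} (v : View i) → sucᵛ v ≢ predᶜ i
  sucᵛ≢predᶜ ‵fromℕ ()
  sucᵛ≢predᶜ (‵inj₁ {i = zero} _) ()
  sucᵛ≢predᶜ (‵inj₁ {i = suc j} _) 2+j≡j =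
    m≢1+n+m (toℕ j) (sym (trans (cong toℕ 2+j≡j) (trans (toℕ-inject₁ (inject₁ j)) (toℕ-inject₁ j))))

nV-C : (n : ℕ) → nV (C (suc n)) ≡ suc n
nV-C n = length-tabulate {n = suc n} (λ i → i)

module _ (k : ℕ) where

  deg-C : (i : Fin (suc (suc (suc k)))) → deg (C (suc (suc (suc k)))) i ≡ 2
  deg-C i = begin
    deg (C n) i
      ≡⟨ length-filterᵇ (cycleAdj m i) (allFin n) ⟩
    count (cycleAdj m i) (allFin n)
      ≡⟨ ∑-cong (cong 𝟙 ∘ cycleAdj-neighbours i) (allFin n) ⟩
    count (λ j → ⌊ sucᶜ i ≟ᶠ j ⌋ ∨ ⌊ predᶜ i ≟ᶠ j ⌋) (allFin n)
      ≡⟨ count-∨ (λ j → ⌊ sucᶜ i ≟ᶠ j ⌋) (λ j → ⌊ predᶜ i ≟ᶠ j ⌋) not-both (allFin n) ⟩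
    count (λ j → ⌊ sucᶜ i ≟ᶠ j ⌋) (allFin n) + count (λ j → ⌊ predᶜ i ≟ᶠ j ⌋) (allFin n)
      ≡⟨ cong₂ _+_ (count-≟-∈ _≟ᶠ_ (allFin⁺ n) (∈-allFin (sucᶜ i)))
                   (count-≟-∈ _≟ᶠ_ (allFin⁺ n) (∈-allFin (predᶜ i))) ⟩
    2 ∎
    where
    open ≡-Reasoning
    m n : ℕ
    m = suc (suc k)
    n = suc m
    not-both : ∀ j → ⌊ sucᶜ i ≟ᶠ j ⌋ ∧ ⌊ predᶜ i ≟ᶠ j ⌋ ≡ false
    not-both j with sucᶜ i ≟ᶠ j
    ... | yes refl = ⌊⌋-no (predᶜ i ≟ᶠ sucᶜ i) (sucᶜ≢predᶜ i ∘ sym)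
    ... | no _     = refl

  C-simple : IsSimple (C (suc (suc (suc k))))
  C-simple = record
    { complete = ∈-allFin
    ; unique   = allFin⁺ _
    ; sym      = λ i j → ∨-comm ⌊ toℕ j ≟ℕ suc (toℕ i) % n ⌋ ⌊ toℕ i ≟ℕ suc (toℕ j) % n ⌋
    ; irrefl   = λ i → trans (cycleAdj-neighbours i i)
        (cong₂ _∨_ (⌊⌋-no (sucᶜ i ≟ᶠ i) (sucᶜ≢id i))
                   (⌊⌋-no (predᶜ i ≟ᶠ i)
                          (λ predᶜi≡i → sucᶜ≢id i (trans (cong sucᶜ (sym predᶜi≡i)) (sucᶜ-predᶜ i)))))
    }
    where
    n : ℕ
    n = suc (suc (suc k))

  nE-C : nE (C (suc (suc (suc k)))) ≡ suc (suc (suc k))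
  nE-C = *-cancelˡ-≡ (nE (C n)) n 2
    (trans (handshake-regular (C n) deg-C C-simple) (trans (cong (_* 2) (nV-C (suc (suc k)))) (*-comm n 2)))
    where
    n : ℕ
    n = suc (suc (suc k))

corollary1 : (n : ℕ) → 3 ≤ n → (H : Graph) → IsSimple H → Connected H →
    F (C n +S H) ≡ n * F H + 6 * n * M₁ H + 24 * n * nE H + 16 * n * nV H
corollary1 (suc zero) (s≤s ())
corollary1 (suc (suc zero)) (s≤s (s≤s ()))
corollary1 n@(suc (suc (suc k))) _ H H-simple _ = begin
  F (C n +S H)
    ≡⟨ F-+S (C-simple k) H-simple ⟩
  nV (C n) * F H + 6 * nE (C n) * M₁ H + 6 * nE H * M₁ (C n) + nV H * F (C n) + 8 * nE (C n) * nV H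
    ≡⟨ cong₂ (λ v e → v * F H + 6 * e * M₁ H + 6 * nE H * M₁ (C n) + nV H * F (C n) + 8 * e * nV H)
             nV-Cn (nE-C k) ⟩
  n * F H + 6 * n * M₁ H + 6 * nE H * M₁ (C n) + nV H * F (C n) + 8 * n * nV H
    ≡⟨ cong₂ (λ s t → n * F H + 6 * n * M₁ H + 6 * nE H * s + nV H * t + 8 * n * nV H)
             (trans (M₁-regular (C n) (deg-C k)) (cong (_* 4) nV-Cn))
             (trans (F-regular (C n) (deg-C k)) (cong (_* 8) nV-Cn)) ⟩
  n * F H + 6 * n * M₁ H + 6 * nE H * (n * 4) + nV H * (n * 8) + 8 * n * nV H
    ≡⟨ collect n (F H) (M₁ H) (nE H) (nV H) ⟩
  n * F H + 6 * n * M₁ H + 24 * n * nE H + 16 * n * nV H ∎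
  where
  open ≡-Reasoning
  nV-Cn : nV (C n) ≡ n
  nV-Cn = nV-C (suc (suc k))
  collect : ∀ n f m e v → n * f + 6 * n * m + 6 * e * (n * 4) + v * (n * 8) + 8 * n * v
                          ≡ n * f + 6 * n * m + 24 * n * e + 16 * n * v
  collect = solve-∀
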